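{- There are only finitely many pairs of integers $(m,w)$ with $4\le w\le m-2$ for which an $I(m,w)$ admissible set exists.
   Context: For $m\ge 1$ let $[m]=\{1,\dots,m\}$. For $v\in\{0,1,2\}^m$, the support of $v$ is $\mathrm{Supp}\, v=\{i\in[m]: v_i\neq 0\}$; for $S\subseteq[m]$ let $V_S$ be the set of vectors in $\{0,1,2\}^m$ with support exactly $S$. A subset of $\{0,1,2\}^m$ is called $I(m,w)$ if it contains exactly one element of $V_S$ for each $S\subseteq[m]$ with $|S|=w$, and no other elements. Two vectors $v_1,v_2$ form a clash if $\mathrm{Supp}\, v_1\subseteq \mathrm{Supp}\, v_2$. Three vectors $v_1,v_2,v_3\in\{0,1,2\}^m$ form a clash if there is no coordinate $i$ at which exactly one of $v_1,v_2,v_3$ is non-zero, and no coordinate $i$ at which the three values $(v_1)_i,(v_2)_i,(v_3)_i$ are pairwise distinct (i.e. exactly two are non-zero and they differ). A subset of $\{0,1,2\}^m$ is admissible if it contains no clash (no two distinct elements forming a clash and no three distinct elements forming a clash). -}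

module Defs where

open import Data.Nat using (ℕ; zero; suc; _+_; _≤_; _∸_)
open import Data.Fin using (Fin; zero; suc)
open import Data.Bool using (Bool; true; false)
open import Data.Vec using (Vec; map; lookup)
open import Data.Fin.Subset using (Subset; _⊆_; ∣_∣)
open import Data.Product using (Σ; _×_; ∃; _,_)
open import Relation.Binary.PropositionalEquality using (_≡_; _≢_)
open import Relation.Nullary using (¬_)

Vec3 : ℕ → Set
Vec3 m = Vec (Fin 3) m

Family : ℕ → Set₁
Family m = Vec3 m → Set

nonzero : Fin 3 → Bool
nonzero zero = false
nonzero (suc _) = true

Supp : ∀ {m} → Vec3 m → Subset m
Supp v = map nonzero v

IsI : (m w : ℕ) → Family m → Set
IsI m w X =
  (∀ v → X v → ∣ Supp v ∣ ≡ w) ×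
  (∀ (S : Subset m) → ∣ S ∣ ≡ w →
     Σ (Vec3 m) λ v → X v × Supp v ≡ S × (∀ u → X u → Supp u ≡ S → u ≡ v))

nz : Fin 3 → ℕ
nz zero = 0
nz (suc _) = 1

ExactlyOneNonzero : Fin 3 → Fin 3 → Fin 3 → Set
ExactlyOneNonzero a b c = nz a + nz b + nz c ≡ 1

PairwiseDistinct : Fin 3 → Fin 3 → Fin 3 → Set
PairwiseDistinct a b c = a ≢ b × b ≢ c × a ≢ c

Clash2 : ∀ {m} → Vec3 m → Vec3 m → Set
Clash2 v₁ v₂ = Supp v₁ ⊆ Supp v₂

Clash3 : ∀ {m} → Vec3 m → Vec3 m → Vec3 m → Set
Clash3 {m} v₁ v₂ v₃ =
  (∀ (i : Fin m) → ¬ ExactlyOneNonzero (lookup v₁ i) (lookup v₂ i) (lookup v₃ i)) ×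
  (∀ (i : Fin m) → ¬ PairwiseDistinct (lookup v₁ i) (lookup v₂ i) (lookup v₃ i))

Admissible : ∀ {m} → Family m → Set
Admissible X =
  (∀ v₁ v₂ → X v₁ → X v₂ → v₁ ≢ v₂ → ¬ Clash2 v₁ v₂) ×
  (∀ v₁ v₂ v₃ → X v₁ → X v₂ → X v₃ → v₁ ≢ v₂ → v₂ ≢ v₃ → v₁ ≢ v₃ → ¬ Clash3 v₁ v₂ v₃)

ExistsAdmissibleI : ℕ → ℕ → Set₁
ExistsAdmissibleI m w = Σ (Family m) λ X → IsI m w X × Admissible X

-- Three members of X clash as soon as, at every coordinate, they have no nonzero entry, three nonzero
-- entries, or two equal nonzero entries.  Fix a set G of K coordinates and apply the hypergraph
-- Ramsey theorem to one of two colourings.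
--   If K = m − w + 4, colour each 4-subset T of G by the values on T of the member supported on
--   T ∪ ∁G.  On a homogeneous 6-subset the values of the fifteen such members are all determined
--   by one colour (k₀, k₁, k₂, k₃) of nonzero values, and for every such colour three of them clash.
--   If K = w + 2, colour each triple a < b < c of G by the values at a, b, c of the members
--   supported on G ∖ {b, c}, G ∖ {a, c}, G ∖ {a, b}.  On a homogeneous 6-subset three of the
--   members supported on G minus a pair again clash.
-- So m − w + 4 and w + 2 are both below Ramsey numbers, which bounds m and w.

module Submission where

open import Defs
open import Data.Bool using (Bool; true; false; _∨_; _∧_; not; if_then_else_)
import Data.Bool as Bool
open import Data.Bool.Properties using (∨-assoc; ∨-identityʳ; ∨-inverseʳ; ∧-identityʳ; ∧-zeroʳ)
open import Data.Empty using (⊥)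
open import Data.Fin using (Fin; zero; suc; _≟_)
open import Data.Fin.Properties using (all?; any?)
open import Data.Fin.Subset using (Subset; ∣_∣)
open import Data.Fin.Subset.Properties using (∣⊥∣≡0; ∣⊤∣≡n)
open import Data.List using (List; []; _∷_; length; map; take; filter; allFin; upTo; cartesianProduct; cartesianProductWith)
open import Data.List.Properties using (length-map; length-take; length-tabulate; filter-all; ≡-dec)
import Data.List.Relation.Binary.Sublist.Propositional as Sublist
open Sublist using (_⊆_; []; _∷_; _∷ʳ_; ⊆-trans)
open import Data.List.Relation.Binary.Sublist.Propositional.Properties
  using (All-resp-⊆; Any-resp-⊆; map⁺; take-⊆; filter-⊆)
open import Data.List.Relation.Unary.All as All using (All; []; _∷_)
open import Data.List.Relation.Unary.All.Properties using (all-filter; filter⁺)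
open import Data.List.Relation.Unary.Any as Any using (Any; here; there)
open import Data.List.Relation.Unary.Unique.Propositional using (Unique; []; _∷_)
open import Data.List.Relation.Unary.Unique.Propositional.Properties using (Unique[x∷xs]⇒x∉xs; take⁺; allFin⁺)
open import Data.List.Membership.Propositional using (_∈_; _∉_)
open import Data.List.Membership.Propositional.Properties
  using (∈-allFin; ∈-upTo⁺; ∈-cartesianProduct⁺; ∈-cartesianProductWith⁺)
import Data.List.Membership.DecPropositional as DecMembership
open import Data.Nat using (ℕ; zero; suc; _+_; _*_; _∸_; _≤_; _<_; _⊓_; s≤s; _≤?_)
import Data.Nat as ℕ
open import Data.Nat.Properties
  using (≤-reflexive; ≤-trans; <-≤-trans; ≤-<-trans; <⇒≤; ≰⇒>; +-suc; +-comm; +-assoc; +-identityʳ;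
         +-cancelˡ-≡; +-cancelˡ-<; +-monoˡ-≤; +-monoʳ-≤; +-mono-<; suc-injective;
         m≤m+n; m∸n≤m; m∸n+n≡m; m+[n∸m]≡n; m≤n⇒m⊓n≡m)
open import Data.Product using (Σ; Σ-syntax; ∃-syntax; _×_; _,_; proj₁; proj₂)
open import Data.Vec using (Vec; []; _∷_; lookup; toList; fromList; tabulate; replicate; _[_]≔_)
import Data.Vec as Vec
open import Data.Vec.Properties
  using (lookup-map; lookup∘tabulate; tabulate-cong; toList∘fromList; lookup∘update; []≔-idempotent; []≔-lookup)
open import Data.Vec.Membership.Propositional.Properties using (∈-lookup; ∈-toList⁺; ∈-toList⁻)
open import Data.Vec.Relation.Unary.Any.Properties using (lookup-index)
open import Function using (_∘_)
open import Level using (0ℓ)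
open import Relation.Binary.Definitions using (DecidableEquality)
open import Relation.Binary.PropositionalEquality
  using (_≡_; _≢_; _≗_; refl; sym; trans; cong; cong₂; subst; module ≡-Reasoning)
open import Relation.Nullary using (Dec; yes; no; ¬_; ¬?; does; contradiction)
open import Relation.Nullary.Decidable using (_×-dec_; _→-dec_; toWitness; dec-true; dec-false)
open import Relation.Unary using (Pred; Decidable)
open import Relation.Unary.Properties using (∁?)

open ≡-Reasoning

private variable A B C : Set

pattern 𝟏 = suc zero
pattern 𝟐 = suc (suc zero)
pattern I = true
pattern O = false

-- Hypergraph Ramsey theorem

length-filter+length-filter-∁ : ∀ {P : Pred A 0ℓ} (P? : Decidable P) xs →
  length (filter P? xs) + length (filter (∁? P?) xs) ≡ length xs
length-filter+length-filter-∁ P? [] = refl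
length-filter+length-filter-∁ P? (x ∷ xs) with P? x
... | yes _ = cong suc (length-filter+length-filter-∁ P? xs)
... | no _ = trans (+-suc _ _) (cong suc (length-filter+length-filter-∁ P? xs))

sublist-of-length : ∀ {P : Pred A 0ℓ} (P? : Decidable P) n E → n ≤ length (filter P? E) →
  ∃[ E′ ] E′ ⊆ E × length E′ ≡ n × All P E′
sublist-of-length P? n E n≤ =
  take n (filter P? E) , ⊆-trans (take-⊆ n _) (filter-⊆ P? E) ,
  trans (length-take n _) (m≤n⇒m⊓n≡m n≤) , All-resp-⊆ (take-⊆ n _) (all-filter P? E)

pigeonhole : DecidableEquality C → (cs : List C) (colour : A → C) (n : ℕ) (E : List A) →
  All (λ x → colour x ∈ cs) E → length cs * n < length E →
  ∃[ k ] k ∈ cs × ∃[ E′ ] E′ ⊆ E × length E′ ≡ n × All (λ x → colour x ≡ k) E′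
pigeonhole _≟_ [] colour n [] _ ()
pigeonhole _≟_ [] colour n (x ∷ E) (() ∷ _) _
pigeonhole _≟_ (c ∷ cs) colour n E inCs cs<E with n ≤? length (filter (λ x → colour x ≟ c) E)
... | yes n≤same = c , here refl , sublist-of-length _ n E n≤same
... | no n≰same =
  let k , k∈cs , E′ , E′⊆ , rest = pigeonhole _≟_ cs colour n (filter (∁? (λ x → colour x ≟ c)) E)
                                      (All.zipWith others (filter⁺ _ inCs , all-filter _ E)) cs<rest
  in k , there k∈cs , E′ , ⊆-trans E′⊆ (filter-⊆ _ E) , rest
  where
  others : ∀ {x} → colour x ∈ c ∷ cs × colour x ≢ c → colour x ∈ cs
  others (here x≡c , x≢c) = contradiction x≡c x≢c
  others (there x∈cs , _) = x∈cs
  cs<rest : length cs * n < length (filter (∁? (λ x → colour x ≟ c)) E)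
  cs<rest = +-cancelˡ-< n _ _ (<-≤-trans
    (subst (n + length cs * n <_) (sym (length-filter+length-filter-∁ _ E)) cs<E)
    (+-monoˡ-≤ _ (<⇒≤ (≰⇒> n≰same))))

sequenceBound : (ℕ → ℕ) → ℕ → ℕ
sequenceBound b zero = zero
sequenceBound b (suc j) = suc (b (sequenceBound b j))

-- Opaque because it is a tower of exponentials: letting the conversion checker unfold it is ruinous.
opaque
  ramseyBound : (c r n : ℕ) → ℕ
  ramseyBound c zero n = n
  ramseyBound c (suc r) n = sequenceBound (ramseyBound c r) (suc (c * n))

module Ramsey {A C : Set} (_≟_ : DecidableEquality C) (colours : List C) where

  ColouredBy : ℕ → (List A → C) → Set
  ColouredBy r χ = ∀ T → length T ≡ r → χ T ∈ colours

  Homogeneous : ℕ → (List A → C) → List A → C → Set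
  Homogeneous r χ H k = ∀ {T} → T ⊆ H → length T ≡ r → χ T ≡ k

  Arrows : ℕ → ℕ → ℕ → Set
  Arrows N r n = ∀ χ → ColouredBy r χ → ∀ G → N ≤ length G →
    ∃[ H ] H ⊆ G × length H ≡ n × ∃[ k ] k ∈ colours × Homogeneous r χ H k

  data EndHomogeneous (r : ℕ) (χ : List A → C) : List (A × C) → Set where
    [] : EndHomogeneous r χ []
    _∷_ : ∀ {x k E} → Homogeneous r (χ ∘ (x ∷_)) (map proj₁ E) k → EndHomogeneous r χ E →
          EndHomogeneous r χ ((x , k) ∷ E)

  EndHomogeneous-resp-⊇ : ∀ {r χ E′ E} → E′ ⊆ E → EndHomogeneous r χ E → EndHomogeneous r χ E′
  EndHomogeneous-resp-⊇ [] [] = []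
  EndHomogeneous-resp-⊇ (_ ∷ʳ E′⊆E) (_ ∷ eh) = EndHomogeneous-resp-⊇ E′⊆E eh
  EndHomogeneous-resp-⊇ (refl ∷ E′⊆E) (hom ∷ eh) =
    (λ T⊆ → hom (⊆-trans T⊆ (map⁺ proj₁ E′⊆E))) ∷ EndHomogeneous-resp-⊇ E′⊆E eh

  monochromatic⇒homogeneous : ∀ {r χ E k} → EndHomogeneous r χ E → All (λ p → proj₂ p ≡ k) E →
    Homogeneous (suc r) χ (map proj₁ E) k
  monochromatic⇒homogeneous [] [] {[]} [] ()
  monochromatic⇒homogeneous (_ ∷ eh) (_ ∷ mono) (_ ∷ʳ T⊆) ∣T∣ = monochromatic⇒homogeneous eh mono T⊆ ∣T∣
  monochromatic⇒homogeneous (hom ∷ _) (refl ∷ _) (refl ∷ T⊆) ∣T∣ = hom T⊆ (cong ℕ.pred ∣T∣)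

  endHomogeneousSequence : ∀ r → (∀ n → Arrows (ramseyBound (length colours) r n) r n) →
    ∀ j χ → ColouredBy (suc r) χ → ∀ G → sequenceBound (ramseyBound (length colours) r) j ≤ length G →
    ∃[ E ] map proj₁ E ⊆ G × length E ≡ j × EndHomogeneous r χ E × All (λ p → proj₂ p ∈ colours) E
  endHomogeneousSequence r ramsey-r zero χ χ-col G _ = [] , Sublist.minimum G , refl , [] , []
  endHomogeneousSequence r ramsey-r (suc j) χ χ-col (x ∷ G) (s≤s bound)
    with H , H⊆G , ∣H∣ , k , k∈ , hom ← ramsey-r _ (χ ∘ (x ∷_)) (λ T ∣T∣ → χ-col (x ∷ T) (cong suc ∣T∣)) G bound
    with E , E⊆H , ∣E∣ , eh , E∈ ← endHomogeneousSequence r ramsey-r j χ χ-col H (≤-reflexive (sym ∣H∣))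
    = (x , k) ∷ E , refl ∷ ⊆-trans E⊆H H⊆G , cong suc ∣E∣ , (λ T⊆ → hom (⊆-trans T⊆ E⊆H)) ∷ eh , k∈ ∷ E∈

  opaque
    unfolding ramseyBound

    ramsey : ∀ r n → Arrows (ramseyBound (length colours) r n) r n
    ramsey zero n χ χ-col G n≤G =
      take n G , take-⊆ n G , trans (length-take n G) (m≤n⇒m⊓n≡m n≤G) , χ [] , χ-col [] refl , hom
      where
      hom : Homogeneous zero χ (take n G) (χ [])
      hom {[]} _ _ = refl
    ramsey (suc r) n χ χ-col G bound
      with E , E⊆G , ∣E∣ , eh , E∈ ← endHomogeneousSequence r (ramsey r) _ χ χ-col G bound
      with k , k∈ , E′ , E′⊆E , ∣E′∣ , mono ← pigeonhole _≟_ colours proj₂ n E E∈ (≤-reflexive (sym ∣E∣))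
      = map proj₁ E′ , ⊆-trans (map⁺ proj₁ E′⊆E) E⊆G , trans (length-map proj₁ E′) ∣E′∣ , k , k∈ ,
        monochromatic⇒homogeneous (EndHomogeneous-resp-⊇ E′⊆E eh) mono

Unique-resp-⊇ : ∀ {xs ys : List A} → xs ⊆ ys → Unique ys → Unique xs
Unique-resp-⊇ [] [] = []
Unique-resp-⊇ (_ ∷ʳ xs⊆ys) (_ ∷ u) = Unique-resp-⊇ xs⊆ys u
Unique-resp-⊇ (refl ∷ xs⊆ys) (y∉ ∷ u) = All-resp-⊆ xs⊆ys y∉ ∷ Unique-resp-⊇ xs⊆ys u

mask : ∀ {n} → Subset n → Vec A n → List A
mask [] [] = []
mask (true ∷ J) (x ∷ xs) = x ∷ mask J xs
mask (false ∷ J) (x ∷ xs) = mask J xs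

unmask : ∀ {n} → A → Subset n → List A → Vec A n
unmask z [] _ = []
unmask z (false ∷ J) ks = z ∷ unmask z J ks
unmask z (true ∷ J) [] = z ∷ unmask z J []
unmask z (true ∷ J) (k ∷ ks) = k ∷ unmask z J ks

mask-⊆ : ∀ {n} (J : Subset n) (xs : Vec A n) → mask J xs ⊆ toList xs
mask-⊆ [] [] = []
mask-⊆ (true ∷ J) (x ∷ xs) = refl ∷ mask-⊆ J xs
mask-⊆ (false ∷ J) (x ∷ xs) = x ∷ʳ mask-⊆ J xs

length-mask : ∀ {n} (J : Subset n) (xs : Vec A n) → length (mask J xs) ≡ ∣ J ∣
length-mask [] [] = refl
length-mask (true ∷ J) (x ∷ xs) = cong suc (length-mask J xs)
length-mask (false ∷ J) (x ∷ xs) = length-mask J xs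

map-mask : ∀ {n} (f : A → B) (J : Subset n) (xs : Vec A n) → map f (mask J xs) ≡ mask J (Vec.map f xs)
map-mask f [] [] = refl
map-mask f (true ∷ J) (x ∷ xs) = cong (f x ∷_) (map-mask f J xs)
map-mask f (false ∷ J) (x ∷ xs) = map-mask f J xs

All-mask : ∀ {P : A → Set} {n} (J : Subset n) (xs : Vec A n) →
  (∀ j → lookup J j ≡ true → P (lookup xs j)) → All P (mask J xs)
All-mask [] [] _ = []
All-mask (true ∷ J) (x ∷ xs) p = p zero refl ∷ All-mask J xs (λ j → p (suc j))
All-mask (false ∷ J) (x ∷ xs) p = All-mask J xs (λ j → p (suc j))

lookup-unmask-mask : ∀ {n} (z : A) (J : Subset n) (xs : Vec A n) {j} → lookup J j ≡ true →
  lookup (unmask z J (mask J xs)) j ≡ lookup xs j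
lookup-unmask-mask z (true ∷ J) (x ∷ xs) {zero} _ = refl
lookup-unmask-mask z (true ∷ J) (x ∷ xs) {suc j} Jⱼ = lookup-unmask-mask z J xs Jⱼ
lookup-unmask-mask z (false ∷ J) (x ∷ xs) {suc j} Jⱼ = lookup-unmask-mask z J xs Jⱼ

lookup-unmask-outside : ∀ {n} (z : A) (J : Subset n) (ks : List A) {j} → lookup J j ≡ false →
  lookup (unmask z J ks) j ≡ z
lookup-unmask-outside z (false ∷ J) ks {zero} _ = refl
lookup-unmask-outside z (false ∷ J) ks {suc j} Jⱼ = lookup-unmask-outside z J ks Jⱼ
lookup-unmask-outside z (true ∷ J) [] {suc j} Jⱼ = lookup-unmask-outside z J [] Jⱼ
lookup-unmask-outside z (true ∷ J) (k ∷ ks) {suc j} Jⱼ = lookup-unmask-outside z J ks Jⱼ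

lookup-∈-mask : ∀ {n} (J : Subset n) (xs : Vec A n) {j} → lookup J j ≡ true → lookup xs j ∈ mask J xs
lookup-∈-mask (true ∷ J) (x ∷ xs) {zero} _ = here refl
lookup-∈-mask (true ∷ J) (x ∷ xs) {suc j} Jⱼ = there (lookup-∈-mask J xs Jⱼ)
lookup-∈-mask (false ∷ J) (x ∷ xs) {suc j} Jⱼ = lookup-∈-mask J xs Jⱼ

∉-mask : ∀ {n} (J : Subset n) (xs : Vec A n) {x} → x ∉ toList xs → x ∉ mask J xs
∉-mask J xs x∉ x∈ = x∉ (Any-resp-⊆ (mask-⊆ J xs) x∈)

lookup-∉-mask : ∀ {n} (J : Subset n) (xs : Vec A n) {j} → Unique (toList xs) → lookup J j ≡ false →
  lookup xs j ∉ mask J xs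
lookup-∉-mask (false ∷ J) (x ∷ xs) {zero} (x∉ ∷ _) _ = ∉-mask J xs (λ x∈ → All.lookup x∉ x∈ refl)
lookup-∉-mask (true ∷ J) (x ∷ xs) {suc j} (x∉ ∷ _) _ (here xⱼ≡x) =
  All.lookup x∉ (∈-toList⁺ (∈-lookup j xs)) (sym xⱼ≡x)
lookup-∉-mask (true ∷ J) (x ∷ xs) {suc j} (_ ∷ u) Jⱼ (there xⱼ∈) = lookup-∉-mask J xs u Jⱼ xⱼ∈
lookup-∉-mask (false ∷ J) (x ∷ xs) {suc j} (_ ∷ u) Jⱼ xⱼ∈ = lookup-∉-mask J xs u Jⱼ xⱼ∈

module Removal (_≟_ : DecidableEquality A) where

  _∖_ : List A → A → List A
  T ∖ x = filter (λ y → ¬? (y ≟ x)) T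

  ∖-mask : ∀ {n} (J : Subset n) (xs : Vec A n) j → Unique (toList xs) →
    mask J xs ∖ lookup xs j ≡ mask (J [ j ]≔ false) xs
  ∖-mask (true ∷ J) (x ∷ xs) zero (x∉ ∷ _) rewrite dec-true (x ≟ x) refl =
    filter-all _ (All-resp-⊆ (mask-⊆ J xs) (All.map (λ x≢y y≡x → x≢y (sym y≡x)) x∉))
  ∖-mask (false ∷ J) (x ∷ xs) zero (x∉ ∷ _) =
    filter-all _ (All-resp-⊆ (mask-⊆ J xs) (All.map (λ x≢y y≡x → x≢y (sym y≡x)) x∉))
  ∖-mask (true ∷ J) (x ∷ xs) (suc j) (x∉ ∷ u)
    rewrite dec-false (x ≟ lookup xs j) (All.lookup x∉ (∈-toList⁺ (∈-lookup j xs))) =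
    cong (x ∷_) (∖-mask J xs j u)
  ∖-mask (false ∷ J) (x ∷ xs) (suc j) (_ ∷ u) = ∖-mask J xs j u

∣p[j]≔true∣ : ∀ {n} (J : Subset n) j → lookup J j ≡ false → ∣ J [ j ]≔ true ∣ ≡ suc ∣ J ∣
∣p[j]≔true∣ (false ∷ J) zero _ = refl
∣p[j]≔true∣ (true ∷ J) (suc j) Jⱼ = cong suc (∣p[j]≔true∣ J j Jⱼ)
∣p[j]≔true∣ (false ∷ J) (suc j) Jⱼ = ∣p[j]≔true∣ J j Jⱼ

suc∣p[j]≔false∣ : ∀ {n} (J : Subset n) j → lookup J j ≡ true → suc ∣ J [ j ]≔ false ∣ ≡ ∣ J ∣
suc∣p[j]≔false∣ (true ∷ J) zero _ = refl
suc∣p[j]≔false∣ (true ∷ J) (suc j) Jⱼ = cong suc (suc∣p[j]≔false∣ J j Jⱼ)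
suc∣p[j]≔false∣ (false ∷ J) (suc j) Jⱼ = suc∣p[j]≔false∣ J j Jⱼ

[]≔-restore : ∀ {n} (xs : Vec A n) j {x y} → lookup xs j ≡ y → (xs [ j ]≔ x) [ j ]≔ y ≡ xs
[]≔-restore xs j refl = trans ([]≔-idempotent xs j) ([]≔-lookup xs j)

tabulate-const : ∀ n (x : A) → tabulate {n = n} (λ _ → x) ≡ replicate n x
tabulate-const zero x = refl
tabulate-const (suc n) x = cong (x ∷_) (tabulate-const n x)

∣tabulate-≟∨∣ : ∀ {m} (f : Fin m → Bool) t → f t ≡ false → ∣ tabulate (λ x → does (x ≟ t) ∨ f x) ∣ ≡ suc ∣ tabulate f ∣
∣tabulate-≟∨∣ f zero f₀ rewrite f₀ = refl
∣tabulate-≟∨∣ f (suc t) fₜ with f zero | ∣tabulate-≟∨∣ (f ∘ suc) t fₜ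
... | true | eq = cong suc eq
... | false | eq = eq

module _ {m : ℕ} where
  open DecMembership (_≟_ {m}) using (_∈?_)

  _∈ᵇ_ : Fin m → List (Fin m) → Bool
  x ∈ᵇ T = does (x ∈? T)

  ∣tabulate-∈ᵇ∨∣ : (f : Fin m → Bool) (T : List (Fin m)) → Unique T → All (λ t → f t ≡ false) T →
    ∣ tabulate (λ x → x ∈ᵇ T ∨ f x) ∣ ≡ length T + ∣ tabulate f ∣
  ∣tabulate-∈ᵇ∨∣ f [] _ _ = refl
  ∣tabulate-∈ᵇ∨∣ f (t ∷ T) u@(_ ∷ uT) (fₜ ∷ fT) = begin
    ∣ tabulate (λ x → (does (x ≟ t) ∨ x ∈ᵇ T) ∨ f x) ∣ ≡⟨ cong ∣_∣ (tabulate-cong (λ x → ∨-assoc (does (x ≟ t)) _ _)) ⟩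
    ∣ tabulate (λ x → does (x ≟ t) ∨ (x ∈ᵇ T ∨ f x)) ∣ ≡⟨ ∣tabulate-≟∨∣ _ t (cong₂ _∨_ (dec-false (t ∈? T) (Unique[x∷xs]⇒x∉xs u)) fₜ) ⟩
    suc ∣ tabulate (λ x → x ∈ᵇ T ∨ f x) ∣               ≡⟨ cong suc (∣tabulate-∈ᵇ∨∣ f T uT fT) ⟩
    suc (length T + ∣ tabulate f ∣)                      ∎

  lookup-∈ᵇ-mask : ∀ {n} (J : Subset n) (h : Vec (Fin m) n) j → Unique (toList h) → lookup h j ∈ᵇ mask J h ≡ lookup J j
  lookup-∈ᵇ-mask J h j uh with lookup J j in Jⱼ
  ... | true = dec-true (_ ∈? mask J h) (lookup-∈-mask J h Jⱼ)
  ... | false = dec-false (_ ∈? mask J h) (lookup-∉-mask J h uh Jⱼ)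

  ∉ᵇ-mask : ∀ {n} (J : Subset n) (h : Vec (Fin m) n) {x} → x ∉ toList h → x ∈ᵇ mask J h ≡ false
  ∉ᵇ-mask J h x∉h = dec-false (_ ∈? mask J h) (∉-mask J h x∉h)

-- Clashes read off coordinatewise

ClashColumn : Fin 3 → Fin 3 → Fin 3 → Set
ClashColumn a b c = ¬ ExactlyOneNonzero a b c × ¬ PairwiseDistinct a b c

clashColumn? : ∀ a b c → Dec (ClashColumn a b c)
clashColumn? a b c = ¬? (nz a + nz b + nz c ℕ.≟ 1) ×-dec ¬? (¬? (a ≟ b) ×-dec ¬? (b ≟ c) ×-dec ¬? (a ≟ c))

clashColumn-uniform : ∀ a b c → nonzero a ≡ nonzero b → nonzero b ≡ nonzero c → ClashColumn a b c
clashColumn-uniform = toWitness {a? = all? λ a → all? λ b → all? λ c →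
  (nonzero a Bool.≟ nonzero b) →-dec (nonzero b Bool.≟ nonzero c) →-dec clashColumn? a b c} _

entries : ∀ {m n} → Vec3 m → Vec (Fin m) n → Fin n → Fin 3
entries v h j = lookup v (lookup h j)

Differ : ∀ {n} → (Fin n → Fin 3) → (Fin n → Fin 3) → Set
Differ r s = ∃[ j ] r j ≢ s j

ClashingRows : ∀ {n} (r₁ r₂ r₃ : Fin n → Fin 3) → Set
ClashingRows r₁ r₂ r₃ = Differ r₁ r₂ × Differ r₂ r₃ × Differ r₁ r₃ × (∀ j → ClashColumn (r₁ j) (r₂ j) (r₃ j))

clashingRows? : ∀ {n} (r₁ r₂ r₃ : Fin n → Fin 3) → Dec (ClashingRows r₁ r₂ r₃)
clashingRows? r₁ r₂ r₃ =
  differ? r₁ r₂ ×-dec differ? r₂ r₃ ×-dec differ? r₁ r₃ ×-dec all? (λ j → clashColumn? (r₁ j) (r₂ j) (r₃ j))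
  where
  differ? : ∀ r s → Dec (Differ r s)
  differ? r s = any? (λ j → ¬? (r j ≟ s j))

ClashingRows-resp-≗ : ∀ {n} {r₁ r₂ r₃ s₁ s₂ s₃ : Fin n → Fin 3} → r₁ ≗ s₁ → r₂ ≗ s₂ → r₃ ≗ s₃ →
  ClashingRows s₁ s₂ s₃ → ClashingRows r₁ r₂ r₃
ClashingRows-resp-≗ {r₁ = r₁} {r₂} {r₃} e₁ e₂ e₃ (d₁₂ , d₂₃ , d₁₃ , columns) =
  differ e₁ e₂ d₁₂ , differ e₂ e₃ d₂₃ , differ e₁ e₃ d₁₃ , column
  where
  differ : ∀ {r r′ s s′} → r ≗ s → r′ ≗ s′ → Differ s s′ → Differ r r′
  differ e e′ (j , s≢s′) = j , λ r≡r′ → s≢s′ (trans (sym (e j)) (trans r≡r′ (e′ j)))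
  column : ∀ j → ClashColumn (r₁ j) (r₂ j) (r₃ j)
  column j rewrite e₁ j | e₂ j | e₃ j = columns j

noClashingRows : ∀ {m n} {X : Family m} → Admissible X → ∀ {v₁ v₂ v₃} → X v₁ → X v₂ → X v₃ →
  (h : Vec (Fin m) n) →
  (∀ {x} → x ∉ toList h →
     nonzero (lookup v₁ x) ≡ nonzero (lookup v₂ x) × nonzero (lookup v₂ x) ≡ nonzero (lookup v₃ x)) →
  ¬ ClashingRows (entries v₁ h) (entries v₂ h) (entries v₃ h)
noClashingRows (_ , noClash₃) {v₁} {v₂} {v₃} X₁ X₂ X₃ h outside (d₁₂ , d₂₃ , d₁₃ , columns) =
  noClash₃ v₁ v₂ v₃ X₁ X₂ X₃ (distinct d₁₂) (distinct d₂₃) (distinct d₁₃)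
    ((λ x → proj₁ (column x)) , (λ x → proj₂ (column x)))
  where
  distinct : ∀ {v v′} → Differ (entries v h) (entries v′ h) → v ≢ v′
  distinct (j , differs) refl = differs refl
  column : ∀ x → ClashColumn (lookup v₁ x) (lookup v₂ x) (lookup v₃ x)
  column x with any? (λ j → x ≟ lookup h j)
  ... | yes (j , refl) = columns j
  ... | no x∉h = clashColumn-uniform _ _ _ (proj₁ uniform) (proj₂ uniform)
    where uniform = outside (λ x∈ → x∉h (_ , lookup-index (∈-toList⁻ x∈)))

Triple : ℕ → Set
Triple n = Subset n × Subset n × Subset n

PatternClash : ∀ {n} → ℕ → (Subset n → Fin n → Fin 3) → Triple n → Set
PatternClash s row (J₁ , J₂ , J₃) =
  (∣ J₁ ∣ ≡ s × ∣ J₂ ∣ ≡ s × ∣ J₃ ∣ ≡ s) × ClashingRows (row J₁) (row J₂) (row J₃)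

patternClash? : ∀ {n} s (row : Subset n → Fin n → Fin 3) t → Dec (PatternClash s row t)
patternClash? s row (J₁ , J₂ , J₃) =
  (∣ J₁ ∣ ℕ.≟ s ×-dec ∣ J₂ ∣ ℕ.≟ s ×-dec ∣ J₃ ∣ ℕ.≟ s) ×-dec clashingRows? (row J₁) (row J₂) (row J₃)

noPatternClash : ∀ {m n s} {X : Family m} {outside : Fin m → Bool} → Admissible X →
  (h : Vec (Fin m) n) (V : Subset n → Vec3 m) (row : Subset n → Fin n → Fin 3) →
  (∀ J → ∣ J ∣ ≡ s → X (V J)) →
  (∀ J → ∣ J ∣ ≡ s → ∀ {x} → x ∉ toList h → nonzero (lookup (V J) x) ≡ outside x) →
  (∀ J → ∣ J ∣ ≡ s → entries (V J) h ≗ row J) →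
  ∀ t → ¬ PatternClash s row t
noPatternClash adm h V row V∈X off-h rows (J₁ , J₂ , J₃) ((∣J₁∣ , ∣J₂∣ , ∣J₃∣) , clash) =
  noClashingRows adm (V∈X J₁ ∣J₁∣) (V∈X J₂ ∣J₂∣) (V∈X J₃ ∣J₃∣) h
    (λ x∉h → trans (off-h J₁ ∣J₁∣ x∉h) (sym (off-h J₂ ∣J₂∣ x∉h)) , trans (off-h J₂ ∣J₂∣ x∉h) (sym (off-h J₃ ∣J₃∣ x∉h)))
    (ClashingRows-resp-≗ (rows J₁ ∣J₁∣) (rows J₂ ∣J₂∣) (rows J₃ ∣J₃∣) clash)

module Members {m w : ℕ} {X : Family m} (isI : IsI m w X) where

  -- The member of X with support f, or a junk vector when ∣ f ∣ ≢ w, so that colourings built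
  -- from members need no size proofs.
  member : (Fin m → Bool) → Vec3 m
  member f with ∣ tabulate f ∣ ℕ.≟ w
  ... | yes ∣f∣≡w = proj₁ (proj₂ isI (tabulate f) ∣f∣≡w)
  ... | no _ = replicate m zero

  member-∈ : ∀ {f} → ∣ tabulate f ∣ ≡ w → X (member f)
  member-∈ {f} ∣f∣≡w with ∣ tabulate f ∣ ℕ.≟ w
  ... | yes ∣f∣≡w′ = proj₁ (proj₂ (proj₂ isI (tabulate f) ∣f∣≡w′))
  ... | no ∣f∣≢w = contradiction ∣f∣≡w ∣f∣≢w

  nonzero-member : ∀ {f} → ∣ tabulate f ∣ ≡ w → ∀ x → nonzero (lookup (member f) x) ≡ f x
  nonzero-member {f} ∣f∣≡w x with ∣ tabulate f ∣ ℕ.≟ w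
  ... | yes ∣f∣≡w′ = begin
    nonzero (lookup v x)   ≡⟨ sym (lookup-map x nonzero v) ⟩
    lookup (Supp v) x      ≡⟨ cong (λ S → lookup S x) (proj₁ (proj₂ (proj₂ (proj₂ isI (tabulate f) ∣f∣≡w′)))) ⟩
    lookup (tabulate f) x  ≡⟨ lookup∘tabulate f x ⟩
    f x                    ∎
    where v = proj₁ (proj₂ isI (tabulate f) ∣f∣≡w′)
  ... | no ∣f∣≢w = contradiction ∣f∣≡w ∣f∣≢w

nonzero≡false⇒zero : ∀ {a} → nonzero a ≡ false → a ≡ zero
nonzero≡false⇒zero {zero} _ = refl

nonzeroValues : List (Fin 3)
nonzeroValues = 𝟏 ∷ 𝟐 ∷ []

∈-nonzeroValues : ∀ {a} → nonzero a ≡ true → a ∈ nonzeroValues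
∈-nonzeroValues {𝟏} _ = here refl
∈-nonzeroValues {𝟐} _ = there (here refl)

words : List A → ℕ → List (List A)
words as zero = [] ∷ []
words as (suc n) = cartesianProductWith _∷_ as (words as n)

∈-words : ∀ {as : List A} {xs} → All (_∈ as) xs → xs ∈ words as (length xs)
∈-words [] = here refl
∈-words (x∈ ∷ xs∈) = ∈-cartesianProductWith⁺ _∷_ x∈ (∈-words xs∈)

fromList-ofLength : ∀ {n} (H : List A) → length H ≡ n → Σ[ h ∈ Vec A n ] toList h ≡ H
fromList-ofLength H refl = fromList H , toList∘fromList H

R₃ R₄ : ℕ
R₃ = ramseyBound (length (words (allFin 3) 3)) 3 6
R₄ = ramseyBound (length (words (allFin 3) 4)) 4 6

-- Supports T ∪ ∁G for the 4-subsets T of G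

-- Writing kᵢ for the entries of the colour of a homogeneous 6-subset: the first triple of 4-subsets
-- clashes if k₀ = k₁, the second if k₁ = k₂, the third if k₂ = k₃, and the last if k₀ = k₂ and k₁ = k₃.
quadrupleTriples : List (Triple 6)
quadrupleTriples =
  (I ∷ I ∷ I ∷ I ∷ O ∷ O ∷ [] , I ∷ O ∷ I ∷ I ∷ I ∷ O ∷ [] , O ∷ I ∷ I ∷ I ∷ I ∷ O ∷ []) ∷
  (I ∷ I ∷ I ∷ I ∷ O ∷ O ∷ [] , I ∷ I ∷ O ∷ I ∷ I ∷ O ∷ [] , I ∷ O ∷ I ∷ I ∷ I ∷ O ∷ []) ∷
  (I ∷ I ∷ I ∷ I ∷ O ∷ O ∷ [] , I ∷ I ∷ I ∷ O ∷ I ∷ O ∷ [] , I ∷ I ∷ O ∷ I ∷ I ∷ O ∷ []) ∷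
  (I ∷ I ∷ I ∷ I ∷ O ∷ O ∷ [] , I ∷ I ∷ O ∷ O ∷ I ∷ I ∷ [] , O ∷ O ∷ I ∷ I ∷ I ∷ I ∷ []) ∷ []

quadrupleRow : List (Fin 3) → Subset 6 → Fin 6 → Fin 3
quadrupleRow k J = lookup (unmask zero J k)

-- Decided by evaluation; opaque so that type checking never unfolds the evaluated proof.
opaque
  quadrupleClash : ∀ {k} → k ∈ words nonzeroValues 4 → Any (PatternClash 4 (quadrupleRow k)) quadrupleTriples
  quadrupleClash = All.lookup (toWitness {a? = All.all? (λ k → Any.any? (patternClash? 4 (quadrupleRow k)) quadrupleTriples)
                                                         (words nonzeroValues 4)} _)

module QuadrupleCase {m w : ℕ} {X : Family m} (isI : IsI m w X) (adm : Admissible X)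
                     (G : List (Fin m)) (uG : Unique G) (∣G∣+w≡m+4 : length G + w ≡ m + 4) where
  open Members isI
  open DecMembership (_≟_ {m}) using (_∈?_)
  open Ramsey {A = Fin m} (≡-dec _≟_) (words (allFin 3) 4)

  support : List (Fin m) → Fin m → Bool
  support T x = x ∈ᵇ T ∨ not (x ∈ᵇ G)

  vec : List (Fin m) → Vec3 m
  vec T = member (support T)

  colouring : List (Fin m) → List (Fin 3)
  colouring T = map (lookup (vec T)) T

  colouredBy : ColouredBy 4 colouring
  colouredBy T ∣T∣ = subst (λ n → colouring T ∈ words (allFin 3) n) (trans (length-map _ T) ∣T∣)
                       (∈-words (All.universal ∈-allFin _))

  inside-G : All (λ x → not (x ∈ᵇ G) ≡ false) G
  inside-G = All.tabulate (λ x∈G → cong not (dec-true (_ ∈? G) x∈G))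

  ∣G∣+∣∁G∣≡m : length G + ∣ tabulate (λ x → not (x ∈ᵇ G)) ∣ ≡ m
  ∣G∣+∣∁G∣≡m = begin
    length G + ∣ tabulate (λ x → not (x ∈ᵇ G)) ∣  ≡⟨ sym (∣tabulate-∈ᵇ∨∣ _ G uG inside-G) ⟩
    ∣ tabulate (λ x → x ∈ᵇ G ∨ not (x ∈ᵇ G)) ∣   ≡⟨ cong ∣_∣ (tabulate-cong (λ x → ∨-inverseʳ (x ∈ᵇ G))) ⟩
    ∣ tabulate {n = m} (λ _ → true) ∣             ≡⟨ cong ∣_∣ (tabulate-const m true) ⟩
    ∣ replicate m true ∣                          ≡⟨ ∣⊤∣≡n m ⟩
    m                                             ∎

  ∣support∣ : ∀ {T} → T ⊆ G → length T ≡ 4 → ∣ tabulate (support T) ∣ ≡ w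
  ∣support∣ {T} T⊆G ∣T∣ = begin
    ∣ tabulate (support T) ∣ ≡⟨ ∣tabulate-∈ᵇ∨∣ _ T (Unique-resp-⊇ T⊆G uG) (All-resp-⊆ T⊆G inside-G) ⟩
    length T + ∣∁G∣          ≡⟨ cong (_+ ∣∁G∣) ∣T∣ ⟩
    4 + ∣∁G∣                 ≡⟨ +-cancelˡ-≡ (length G) _ _ (begin
      length G + (4 + ∣∁G∣)    ≡⟨ cong (length G +_) (+-comm 4 ∣∁G∣) ⟩
      length G + (∣∁G∣ + 4)    ≡⟨ sym (+-assoc (length G) ∣∁G∣ 4) ⟩
      length G + ∣∁G∣ + 4      ≡⟨ cong (_+ 4) ∣G∣+∣∁G∣≡m ⟩
      m + 4                    ≡⟨ sym ∣G∣+w≡m+4 ⟩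
      length G + w             ∎) ⟩
    w                        ∎
    where ∣∁G∣ = ∣ tabulate (λ x → not (x ∈ᵇ G)) ∣

  noHomogeneousSextuple : ∀ (h : Vec (Fin m) 6) {k} → toList h ⊆ G → Homogeneous 4 colouring (toList h) k → ⊥
  noHomogeneousSextuple h {k} h⊆G hom =
    let t , clash = Any.satisfied (quadrupleClash k∈words) in
    noPatternClash adm h V (quadrupleRow k) (λ J ∣J∣ → member-∈ (∣supp∣ J ∣J∣)) off-h row t clash
    where
    V : Subset 6 → Vec3 m
    V J = vec (mask J h)

    ∣supp∣ : ∀ J → ∣ J ∣ ≡ 4 → ∣ tabulate (support (mask J h)) ∣ ≡ w
    ∣supp∣ J ∣J∣ = ∣support∣ (⊆-trans (mask-⊆ J h) h⊆G) (trans (length-mask J h) ∣J∣)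

    nonzero-V : ∀ J → ∣ J ∣ ≡ 4 → ∀ j → nonzero (entries (V J) h j) ≡ lookup J j
    nonzero-V J ∣J∣ j = begin
      nonzero (entries (V J) h j)                    ≡⟨ nonzero-member (∣supp∣ J ∣J∣) (lookup h j) ⟩
      lookup h j ∈ᵇ mask J h ∨ not (lookup h j ∈ᵇ G) ≡⟨ cong₂ _∨_ (lookup-∈ᵇ-mask J h j (Unique-resp-⊇ h⊆G uG))
                                                          (All.lookup inside-G (Any-resp-⊆ h⊆G (∈-toList⁺ (∈-lookup j h)))) ⟩
      lookup J j ∨ false                             ≡⟨ ∨-identityʳ _ ⟩
      lookup J j                                     ∎

    off-h : ∀ J → ∣ J ∣ ≡ 4 → ∀ {x} → x ∉ toList h → nonzero (lookup (V J) x) ≡ not (x ∈ᵇ G)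
    off-h J ∣J∣ {x} x∉h = trans (nonzero-member (∣supp∣ J ∣J∣) x) (cong (_∨ not (x ∈ᵇ G)) (∉ᵇ-mask J h x∉h))

    colour : ∀ J → ∣ J ∣ ≡ 4 → mask J (Vec.map (lookup (V J)) h) ≡ k
    colour J ∣J∣ = trans (sym (map-mask _ J h)) (hom (mask-⊆ J h) (trans (length-mask J h) ∣J∣))

    row : ∀ J → ∣ J ∣ ≡ 4 → ∀ j → entries (V J) h j ≡ quadrupleRow k J j
    row J ∣J∣ j with lookup J j in Jⱼ
    ... | true = begin
      entries (V J) h j                                            ≡⟨ sym (lookup-map j _ h) ⟩
      lookup (Vec.map (lookup (V J)) h) j                          ≡⟨ sym (lookup-unmask-mask zero J _ Jⱼ) ⟩
      lookup (unmask zero J (mask J (Vec.map (lookup (V J)) h))) j ≡⟨ cong (λ k → lookup (unmask zero J k) j) (colour J ∣J∣) ⟩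
      quadrupleRow k J j                                           ∎
    ... | false = trans (nonzero≡false⇒zero (trans (nonzero-V J ∣J∣ j) Jⱼ)) (sym (lookup-unmask-outside zero J k Jⱼ))

    J₀ : Subset 6
    J₀ = I ∷ I ∷ I ∷ I ∷ O ∷ O ∷ []

    k∈words : k ∈ words nonzeroValues 4
    k∈words = subst (_∈ words nonzeroValues 4) (colour J₀ refl)
      (subst (λ n → mask J₀ r₀ ∈ words nonzeroValues n) (length-mask J₀ r₀) (∈-words (All-mask J₀ r₀ λ j J₀ⱼ →
        ∈-nonzeroValues (trans (cong nonzero (lookup-map j _ h)) (trans (nonzero-V J₀ refl j) J₀ⱼ)))))
      where r₀ = Vec.map (lookup (V J₀)) h

  ∣G∣<R₄ : length G < R₄
  ∣G∣<R₄ = ≰⇒> λ R₄≤∣G∣ →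
    let H , H⊆G , ∣H∣ , k , _ , hom = ramsey 4 6 colouring colouredBy G R₄≤∣G∣
        h , h≡H = fromList-ofLength H ∣H∣
    in noHomogeneousSextuple h (subst (_⊆ G) (sym h≡H) H⊆G) (λ T⊆ → hom (subst (_ ⊆_) h≡H T⊆))

-- Supports G ∖ P for the pairs P ⊆ G

-- A pattern P marks the removed pair.  The first triple clashes if k₁ = k₂, the second if
-- k₀ = k₁, the third if k₀ = k₂.
pairTriples : List (Triple 6)
pairTriples =
  (I ∷ O ∷ O ∷ I ∷ O ∷ O ∷ [] , I ∷ O ∷ I ∷ O ∷ O ∷ O ∷ [] , I ∷ I ∷ O ∷ O ∷ O ∷ O ∷ []) ∷
  (O ∷ O ∷ I ∷ I ∷ O ∷ O ∷ [] , O ∷ I ∷ O ∷ I ∷ O ∷ O ∷ [] , I ∷ O ∷ O ∷ I ∷ O ∷ O ∷ []) ∷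
  (O ∷ O ∷ O ∷ O ∷ I ∷ I ∷ [] , O ∷ O ∷ I ∷ I ∷ O ∷ O ∷ [] , I ∷ I ∷ O ∷ O ∷ O ∷ O ∷ []) ∷ []

pairRow : List (Fin 3) → Subset 6 → Fin 6 → Fin 3
pairRow k P j = if lookup P j then zero else lookup (unmask zero (P [ j ]≔ true) k) j

opaque
  pairClash : ∀ {k} → k ∈ words nonzeroValues 3 → Any (PatternClash 2 (pairRow k)) pairTriples
  pairClash = All.lookup (toWitness {a? = All.all? (λ k → Any.any? (patternClash? 2 (pairRow k)) pairTriples)
                                                    (words nonzeroValues 3)} _)

module PairCase {m w : ℕ} {X : Family m} (isI : IsI m w X) (adm : Admissible X)
                (G : List (Fin m)) (uG : Unique G) (w+2≡∣G∣ : w + 2 ≡ length G) where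
  open Members isI
  open DecMembership (_≟_ {m}) using (_∈?_)
  open Ramsey {A = Fin m} (≡-dec _≟_) (words (allFin 3) 3)
  open Removal (_≟_ {m})

  support : List (Fin m) → Fin m → Bool
  support S x = x ∈ᵇ G ∧ not (x ∈ᵇ S)

  vec : List (Fin m) → Vec3 m
  vec S = member (support S)

  colouring : List (Fin m) → List (Fin 3)
  colouring T = map (λ x → lookup (vec (T ∖ x)) x) T

  colouredBy : ColouredBy 3 colouring
  colouredBy T ∣T∣ = subst (λ n → colouring T ∈ words (allFin 3) n) (trans (length-map _ T) ∣T∣)
                       (∈-words (All.universal ∈-allFin _))

  ∈ᵇ-G : ∀ {x} → x ∈ G → x ∈ᵇ G ≡ true
  ∈ᵇ-G = dec-true (_ ∈? G)

  ∣G∣ : ∣ tabulate (_∈ᵇ G) ∣ ≡ length G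
  ∣G∣ = begin
    ∣ tabulate (_∈ᵇ G) ∣                          ≡⟨ cong ∣_∣ (tabulate-cong (λ x → sym (∨-identityʳ (x ∈ᵇ G)))) ⟩
    ∣ tabulate (λ x → x ∈ᵇ G ∨ false) ∣           ≡⟨ ∣tabulate-∈ᵇ∨∣ _ G uG (All.universal (λ _ → refl) G) ⟩
    length G + ∣ tabulate {n = m} (λ _ → false) ∣ ≡⟨ cong (λ p → length G + ∣ p ∣) (tabulate-const m false) ⟩
    length G + ∣ replicate m false ∣              ≡⟨ cong (length G +_) (∣⊥∣≡0 m) ⟩
    length G + 0                                  ≡⟨ +-identityʳ _ ⟩
    length G                                      ∎

  ∣support∣ : ∀ {S} → S ⊆ G → length S ≡ 2 → ∣ tabulate (support S) ∣ ≡ w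
  ∣support∣ {S} S⊆G ∣S∣ = +-cancelˡ-≡ 2 _ _ (begin
    2 + ∣ tabulate (support S) ∣              ≡⟨ cong (_+ ∣ tabulate (support S) ∣) (sym ∣S∣) ⟩
    length S + ∣ tabulate (support S) ∣       ≡⟨ sym (∣tabulate-∈ᵇ∨∣ _ S (Unique-resp-⊇ S⊆G uG) removed) ⟩
    ∣ tabulate (λ x → x ∈ᵇ S ∨ support S x) ∣ ≡⟨ cong ∣_∣ (tabulate-cong refill) ⟩
    ∣ tabulate (_∈ᵇ G) ∣                      ≡⟨ ∣G∣ ⟩
    length G                                  ≡⟨ sym w+2≡∣G∣ ⟩
    w + 2                                     ≡⟨ +-comm w 2 ⟩
    2 + w                                     ∎)
    where
    removed : All (λ x → support S x ≡ false) S
    removed = All.tabulate (λ x∈S → trans (cong (λ b → _ ∧ not b) (dec-true (_ ∈? S) x∈S)) (∧-zeroʳ _))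
    refill : ∀ x → x ∈ᵇ S ∨ support S x ≡ x ∈ᵇ G
    refill x with x ∈? S
    ... | yes x∈S = sym (∈ᵇ-G (Any-resp-⊆ S⊆G x∈S))
    ... | no _ = ∧-identityʳ _

  noHomogeneousSextuple : ∀ (h : Vec (Fin m) 6) {k} → toList h ⊆ G → Homogeneous 3 colouring (toList h) k → ⊥
  noHomogeneousSextuple h {k} h⊆G hom =
    let t , clash = Any.satisfied (pairClash k∈words) in
    noPatternClash adm h V (pairRow k) (λ P ∣P∣ → member-∈ (∣supp∣ P ∣P∣)) off-h row t clash
    where
    V : Subset 6 → Vec3 m
    V P = vec (mask P h)

    ∣supp∣ : ∀ P → ∣ P ∣ ≡ 2 → ∣ tabulate (support (mask P h)) ∣ ≡ w
    ∣supp∣ P ∣P∣ = ∣support∣ (⊆-trans (mask-⊆ P h) h⊆G) (trans (length-mask P h) ∣P∣)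

    nonzero-V : ∀ P → ∣ P ∣ ≡ 2 → ∀ j → nonzero (entries (V P) h j) ≡ not (lookup P j)
    nonzero-V P ∣P∣ j = begin
      nonzero (entries (V P) h j)                    ≡⟨ nonzero-member (∣supp∣ P ∣P∣) (lookup h j) ⟩
      lookup h j ∈ᵇ G ∧ not (lookup h j ∈ᵇ mask P h) ≡⟨ cong₂ (λ a b → a ∧ not b) (∈ᵇ-G (Any-resp-⊆ h⊆G (∈-toList⁺ (∈-lookup j h))))
                                                                                (lookup-∈ᵇ-mask P h j (Unique-resp-⊇ h⊆G uG)) ⟩
      not (lookup P j)                               ∎

    off-h : ∀ P → ∣ P ∣ ≡ 2 → ∀ {x} → x ∉ toList h → nonzero (lookup (V P) x) ≡ x ∈ᵇ G
    off-h P ∣P∣ {x} x∉h = trans (nonzero-member (∣supp∣ P ∣P∣) x)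
      (trans (cong (λ b → x ∈ᵇ G ∧ not b) (∉ᵇ-mask P h x∉h)) (∧-identityʳ _))

    pick : Subset 6 → Vec (Fin 3) 6
    pick U = Vec.map (λ x → lookup (vec (mask U h ∖ x)) x) h

    lookup-pick : ∀ U j → lookup (pick U) j ≡ entries (V (U [ j ]≔ false)) h j
    lookup-pick U j = trans (lookup-map j _ h)
      (cong (λ S → lookup (vec S) (lookup h j)) (∖-mask U h j (Unique-resp-⊇ h⊆G uG)))

    colour : ∀ U → ∣ U ∣ ≡ 3 → mask U (pick U) ≡ k
    colour U ∣U∣ = trans (sym (map-mask _ U h)) (hom (mask-⊆ U h) (trans (length-mask U h) ∣U∣))

    row : ∀ P → ∣ P ∣ ≡ 2 → ∀ j → entries (V P) h j ≡ pairRow k P j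
    row P ∣P∣ j with lookup P j in Pⱼ
    ... | true = nonzero≡false⇒zero (trans (nonzero-V P ∣P∣ j) (cong not Pⱼ))
    ... | false = begin
      entries (V P) h j                          ≡⟨ cong (λ Q → entries (V Q) h j) (sym ([]≔-restore P j Pⱼ)) ⟩
      entries (V (U [ j ]≔ false)) h j           ≡⟨ sym (lookup-pick U j) ⟩
      lookup (pick U) j                          ≡⟨ sym (lookup-unmask-mask zero U (pick U) (lookup∘update j P true)) ⟩
      lookup (unmask zero U (mask U (pick U))) j ≡⟨ cong (λ k → lookup (unmask zero U k) j)
                                                          (colour U (trans (∣p[j]≔true∣ P j Pⱼ) (cong suc ∣P∣))) ⟩
      lookup (unmask zero U k) j                 ∎
      where U = P [ j ]≔ true

    U₀ : Subset 6
    U₀ = I ∷ I ∷ I ∷ O ∷ O ∷ O ∷ []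

    k∈words : k ∈ words nonzeroValues 3
    k∈words = subst (_∈ words nonzeroValues 3) (colour U₀ refl)
      (subst (λ n → mask U₀ (pick U₀) ∈ words nonzeroValues n) (length-mask U₀ (pick U₀))
        (∈-words (All-mask U₀ (pick U₀) λ j U₀ⱼ → ∈-nonzeroValues (begin
          nonzero (lookup (pick U₀) j)                      ≡⟨ cong nonzero (lookup-pick U₀ j) ⟩
          nonzero (entries (V (U₀ [ j ]≔ false)) h j)       ≡⟨ nonzero-V (U₀ [ j ]≔ false) (suc-injective (suc∣p[j]≔false∣ U₀ j U₀ⱼ)) j ⟩
          not (lookup (U₀ [ j ]≔ false) j)                  ≡⟨ cong not (lookup∘update j U₀ false) ⟩
          true                                              ∎))))

  ∣G∣<R₃ : length G < R₃
  ∣G∣<R₃ = ≰⇒> λ R₃≤∣G∣ →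
    let H , H⊆G , ∣H∣ , k , _ , hom = ramsey 3 6 colouring colouredBy G R₃≤∣G∣
        h , h≡H = fromList-ofLength H ∣H∣
    in noHomogeneousSextuple h (subst (_⊆ G) (sym h≡H) H⊆G) (λ T⊆ → hom (subst (_ ⊆_) h≡H T⊆))

firstCoordinates : ∀ {m} K → K ≤ m → Σ[ G ∈ List (Fin m) ] Unique G × length G ≡ K
firstCoordinates {m} K K≤m =
  take K (allFin m) , take⁺ K (allFin⁺ m) ,
  trans (length-take K (allFin m)) (trans (cong (K ⊓_) (length-tabulate (λ i → i))) (m≤n⇒m⊓n≡m K≤m))

w+2<R₃ : ∀ {m w} → ExistsAdmissibleI m w → w + 2 ≤ m → w + 2 < R₃
w+2<R₃ (X , isI , adm) w+2≤m =
  let G , uG , ∣G∣ = firstCoordinates _ w+2≤m in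
  subst (_< R₃) ∣G∣ (PairCase.∣G∣<R₃ isI adm G uG (sym ∣G∣))

m∸w+4<R₄ : ∀ {m w} → ExistsAdmissibleI m w → 4 ≤ w → w ≤ m → m ∸ w + 4 < R₄
m∸w+4<R₄ {m} {w} (X , isI , adm) 4≤w w≤m =
  let G , uG , ∣G∣ = firstCoordinates _ K≤m in
  subst (_< R₄) ∣G∣ (QuadrupleCase.∣G∣<R₄ isI adm G uG (trans (cong (_+ w) ∣G∣) K+w≡m+4))
  where
  K≤m : m ∸ w + 4 ≤ m
  K≤m = subst (m ∸ w + 4 ≤_) (m∸n+n≡m w≤m) (+-monoʳ-≤ (m ∸ w) 4≤w)
  K+w≡m+4 : m ∸ w + 4 + w ≡ m + 4
  K+w≡m+4 = begin
    m ∸ w + 4 + w     ≡⟨ +-assoc (m ∸ w) 4 w ⟩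
    m ∸ w + (4 + w)   ≡⟨ cong (m ∸ w +_) (+-comm 4 w) ⟩
    m ∸ w + (w + 4)   ≡⟨ sym (+-assoc (m ∸ w) w 4) ⟩
    m ∸ w + w + 4     ≡⟨ cong (_+ 4) (m∸n+n≡m w≤m) ⟩
    m + 4             ∎

w+2≤m : ∀ {m w} → 4 ≤ w → w ≤ m ∸ 2 → w + 2 ≤ m
w+2≤m {suc (suc m)} {w} _ w≤m∸2 = subst (w + 2 ≤_) (+-comm m 2) (+-monoˡ-≤ 2 w≤m∸2)
w+2≤m {zero} (s≤s _) ()
w+2≤m {suc zero} (s≤s _) ()

theorem1 : Σ (List (ℕ × ℕ)) λ L →
    ∀ (m w : ℕ) → 4 ≤ w → w ≤ m ∸ 2 → ExistsAdmissibleI m w → (m , w) ∈ L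
theorem1 = cartesianProduct (upTo (R₃ + R₄)) (upTo R₃) , λ m w 4≤w w≤m∸2 admissibleI →
  let w<R₃ = ≤-<-trans (m≤m+n w 2) (w+2<R₃ admissibleI (w+2≤m 4≤w w≤m∸2))
      w≤m = ≤-trans w≤m∸2 (m∸n≤m m 2)
      m∸w<R₄ = ≤-<-trans (m≤m+n (m ∸ w) 4) (m∸w+4<R₄ admissibleI 4≤w w≤m)
  in ∈-cartesianProduct⁺ (∈-upTo⁺ (subst (_< R₃ + R₄) (m+[n∸m]≡n w≤m) (+-mono-< w<R₃ m∸w<R₄))) (∈-upTo⁺ w<R₃)
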